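{- No algorithm can solve unweighted sorted-no-self-APSD enumeration with both delay and preprocessing in $o(n)$.
   Context: Input: an unweighted graph $G=(V,E)$ with $n$ vertices given as read-only adjacency lists, accessed via degree and next-neighbor queries. $d(u,v)$ is the hop distance ($\infty$ if unreachable). Sorted-no-self-APSD enumeration: output each triple $(u,v,d(u,v))$ with $u\neq v$ exactly once, in nondecreasing order of $d(u,v)$. Preprocessing: time before enumeration starts; delay: maximum time to the first output after preprocessing, between consecutive outputs, and until termination is signalled. -}

module Defs where

open import Data.Nat using (ℕ; zero; suc; _≤_; _<_; _*_)
open import Data.Fin using (Fin)
open import Data.List using (List; []; _∷_; length; map)
open import Data.List.Membership.Propositional using (_∈_; _∉_)
open import Data.List.Relation.Unary.All using (All)
open import Data.List.Relation.Unary.AllPairs using (AllPairs)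
open import Data.List.Relation.Unary.Unique.Propositional using (Unique)
open import Data.Maybe using (Maybe; just; nothing)
open import Data.Product using (_×_; _,_; proj₁; proj₂; Σ; ∃)
open import Data.Empty using (⊥)
open import Relation.Nullary using (¬_)
open import Relation.Binary.PropositionalEquality using (_≡_; _≢_)

record Graph (n : ℕ) : Set where
  field
    adj    : Fin n → List (Fin n)
    symm   : ∀ u v → v ∈ adj u → u ∈ adj v
    noLoop : ∀ u → u ∉ adj u
    simple : ∀ u → Unique (adj u)
open Graph public

nth : ∀ {A : Set} → List A → ℕ → Maybe A
nth []       _       = nothing
nth (x ∷ xs) zero    = just x
nth (x ∷ xs) (suc i) = nth xs i

degree : ∀ {n} → Graph n → Fin n → ℕ
degree G v = length (adj G v)

neighbour : ∀ {n} → Graph n → Fin n → ℕ → Maybe (Fin n)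
neighbour G v i = nth (adj G v) i

data Dist : Set where
  fin : ℕ → Dist
  ∞   : Dist

data _≤D_ : Dist → Dist → Set where
  fin≤fin : ∀ {a b} → a ≤ b → fin a ≤D fin b
  _≤∞     : ∀ d → d ≤D ∞

data Walk {n} (G : Graph n) : Fin n → Fin n → ℕ → Set where
  here : ∀ {u} → Walk G u u 0
  step : ∀ {u v w k} → v ∈ adj G u → Walk G v w k → Walk G u w (suc k)

data IsDist {n} (G : Graph n) (u v : Fin n) : Dist → Set where
  isFin : ∀ {k} → Walk G u v k → (∀ j → j < k → ¬ Walk G u v j) → IsDist G u v (fin k)
  isInf : (∀ k → ¬ Walk G u v k) → IsDist G u v ∞

Triple : ℕ → Set
Triple n = Fin n × Fin n × Dist

pairOf : ∀ {n} → Triple n → Fin n × Fin n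
pairOf (u , v , _) = u , v

distOf : ∀ {n} → Triple n → Dist
distOf (_ , _ , d) = d

ValidTriple : ∀ {n} → Graph n → Triple n → Set
ValidTriple G (u , v , d) = (u ≢ v) × IsDist G u v d

CorrectOutput : ∀ {n} → Graph n → List (Triple n) → Set
CorrectOutput {n} G L =
  All (ValidTriple G) L
  × Unique (map pairOf L)
  × (∀ (u v : Fin n) → u ≢ v → (u , v) ∈ map pairOf L)
  × AllPairs (λ s t → distOf s ≤D distOf t) L

-- Each query costs one time unit;
-- internal computation is free (a more powerful model than a RAM).
-- The preprocessing phase ends with `start`, handing over to the
-- enumeration phase (its state is captured by the continuation).

data Enum (n : ℕ) : Set where
  degQ : Fin n → (ℕ → Enum n) → Enum n
  nbrQ : Fin n → ℕ → (Maybe (Fin n) → Enum n) → Enum n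
  out  : Triple n → Enum n → Enum n
  done : Enum n

data Pre (n : ℕ) : Set where
  degQ  : Fin n → (ℕ → Pre n) → Pre n
  nbrQ  : Fin n → ℕ → (Maybe (Fin n) → Pre n) → Pre n
  start : Enum n → Pre n

Algorithm : Set
Algorithm = (n : ℕ) → Pre n

runPre : ∀ {n} → Pre n → Graph n → ℕ × Enum n
runPre (degQ v k)   G = let r = runPre (k (degree G v)) G in suc (proj₁ r) , proj₂ r
runPre (nbrQ v i k) G = let r = runPre (k (neighbour G v i)) G in suc (proj₁ r) , proj₂ r
runPre (start e)    G = 0 , e

-- run enumeration with a counter c of queries since the last output
-- (or since the start).
runEnum : ∀ {n} → Enum n → Graph n → ℕ → List (ℕ × Triple n) × ℕ
runEnum (degQ v k)   G c = runEnum (k (degree G v)) G (suc c)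
runEnum (nbrQ v i k) G c = runEnum (k (neighbour G v i)) G (suc c)
runEnum (out t m)    G c = let r = runEnum m G 0 in (c , t) ∷ proj₁ r , proj₂ r
runEnum done         G c = [] , c

SolvesWith : Algorithm → (ℕ → ℕ) → (ℕ → ℕ) → Set
SolvesWith A P D = ∀ n (G : Graph n) →
  let pr = runPre (A n) G
      er = runEnum (proj₂ pr) G 0
  in proj₁ pr ≤ P n
     × All (λ x → proj₁ x ≤ D n) (proj₁ er)
     × proj₂ er ≤ D n
     × CorrectOutput G (map proj₂ (proj₁ er))

LittleO : (ℕ → ℕ) → Set
LittleO f = ∀ (c : ℕ) → ∃ λ N → ∀ n → N ≤ n → c * f n ≤ n

-- On the empty graph every pair is at distance ∞, so a correct enumeration
-- starts with a triple of distance ∞, and it does so after at most P + D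
-- queries.  If P + D ≤ n − 2, two vertices a, b were never queried; adding
-- the edge ab changes no answer the algorithm received, so on the new graph
-- it still starts with a distance-∞ triple.  Sortedness then forces every
-- later triple, in particular (a, b, 1), to have distance ∞: a contradiction.
-- Hence P(n) + D(n) ≥ n − 2, which excludes P, D ∈ o(n).
module Submission where

open import Defs
open import Data.Empty using (⊥)
open import Data.Nat using (ℕ; suc; _+_; _*_; _≤_; _<_; s≤s)
open import Data.Nat.Properties
  using ( ≤-trans; ≤-reflexive; +-mono-≤; +-suc; +-identityʳ; m≤m+n; m≤n+m; n≤1+n
        ; *-distribˡ-+; *-cancelˡ-≤; <⇒≱; ≰⇒>; module ≤-Reasoning)
open import Data.Nat.Tactic.RingSolver using (solve-∀)
open import Data.Fin as Fin using (Fin; _≟_)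
open import Data.Fin.Properties using (pigeonhole; ¬∀⟶∃¬) renaming (<⇒≢ to <⇒≢ᶠ)
open import Data.List using (List; []; _∷_; length; map; _++_; head; lookup)
open import Data.List.Properties using (length-++)
open import Data.List.Relation.Unary.Any using (here; there; index; any?)
open import Data.List.Relation.Unary.Any.Properties using (lookup-index)
open import Data.List.Relation.Unary.All using (All; []; _∷_)
import Data.List.Relation.Unary.All as All
open import Data.List.Relation.Unary.All.Properties using (++⁻ˡ; ++⁻ʳ)
open import Data.List.Relation.Unary.AllPairs using ([]; _∷_)
open import Data.List.Relation.Unary.Unique.Propositional using (Unique)
open import Data.List.Membership.Propositional using (_∈_; _∉_)
open import Data.List.Membership.Propositional.Properties using (∈-map⁻)
open import Data.Maybe using (just)
open import Data.Product using (_×_; _,_; proj₁; proj₂; ∃; ∃₂)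
open import Data.Sum using (_⊎_; inj₁; inj₂)
open import Relation.Nullary using (¬_; yes; no; contradiction)
open import Relation.Binary.PropositionalEquality

∉-exists : ∀ {n} (L : List (Fin n)) → length L < n → ∃ λ v → v ∉ L
∉-exists {n} L len<n = ¬∀⟶∃¬ n (_∈ L) (λ v → any? (v ≟_) L) covers-all
  where
  covers-all : ¬ (∀ v → v ∈ L)
  covers-all ∈L with pigeonhole len<n (λ v → index (∈L v))
  ... | i , j , i<j , same-index = <⇒≢ᶠ i<j (begin
    i                       ≡⟨ lookup-index (∈L i) ⟩
    lookup L (index (∈L i)) ≡⟨ cong (lookup L) same-index ⟩
    lookup L (index (∈L j)) ≡⟨ lookup-index (∈L j) ⟨
    j                       ∎)
    where open ≡-Reasoning

∉-pair-exists : ∀ {n} (L : List (Fin (2 + n))) → length L ≤ n →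
                ∃₂ λ a b → a ≢ b × a ∉ L × b ∉ L
∉-pair-exists L len≤n with ∉-exists L (s≤s (≤-trans len≤n (n≤1+n _)))
... | a , a∉L with ∉-exists (a ∷ L) (s≤s (s≤s len≤n))
... | b , b∉a∷L =
  a , b , (λ a≡b → b∉a∷L (here (sym a≡b))) , a∉L , (λ b∈L → b∉a∷L (there b∈L))

AgreeOn : ∀ {n} → Graph n → Graph n → List (Fin n) → Set
AgreeOn G H = All (λ v → adj G v ≡ adj H v)

preQueries : ∀ {n} → Pre n → Graph n → List (Fin n)
preQueries (degQ v k)   G = v ∷ preQueries (k (degree G v)) G
preQueries (nbrQ v i k) G = v ∷ preQueries (k (neighbour G v i)) G
preQueries (start e)    G = []

length-preQueries : ∀ {n} (p : Pre n) G → length (preQueries p G) ≡ proj₁ (runPre p G)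
length-preQueries (degQ v k)   G = cong suc (length-preQueries (k (degree G v)) G)
length-preQueries (nbrQ v i k) G = cong suc (length-preQueries (k (neighbour G v i)) G)
length-preQueries (start e)    G = refl

runPre-local : ∀ {n} (p : Pre n) (G H : Graph n) →
               AgreeOn G H (preQueries p G) → runPre p G ≡ runPre p H
runPre-local (degQ v k) G H (same ∷ agree)
  rewrite runPre-local (k (degree G v)) G H agree | same = refl
runPre-local (nbrQ v i k) G H (same ∷ agree)
  rewrite runPre-local (k (neighbour G v i)) G H agree | same = refl
runPre-local (start e) G H agree = refl

queriesUntilFirstOutput : ∀ {n} → Enum n → Graph n → List (Fin n)
queriesUntilFirstOutput (degQ v k)   G = v ∷ queriesUntilFirstOutput (k (degree G v)) G
queriesUntilFirstOutput (nbrQ v i k) G = v ∷ queriesUntilFirstOutput (k (neighbour G v i)) G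
queriesUntilFirstOutput (out t e)    G = []
queriesUntilFirstOutput done         G = []

head-runEnum-local : ∀ {n} (e : Enum n) (G H : Graph n) c →
                     AgreeOn G H (queriesUntilFirstOutput e G) →
                     head (proj₁ (runEnum e G c)) ≡ head (proj₁ (runEnum e H c))
head-runEnum-local (degQ v k) G H c (same ∷ agree)
  rewrite head-runEnum-local (k (degree G v)) G H (suc c) agree | same = refl
head-runEnum-local (nbrQ v i k) G H c (same ∷ agree)
  rewrite head-runEnum-local (k (neighbour G v i)) G H (suc c) agree | same = refl
head-runEnum-local (out t e) G H c _ = refl
head-runEnum-local done      G H c _ = refl

head-runEnum-delay : ∀ {n} (e : Enum n) G c {m t} →
                     head (proj₁ (runEnum e G c)) ≡ just (m , t) →
                     c + length (queriesUntilFirstOutput e G) ≡ m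
head-runEnum-delay (degQ v k) G c first =
  trans (+-suc c _) (head-runEnum-delay (k (degree G v)) G (suc c) first)
head-runEnum-delay (nbrQ v i k) G c first =
  trans (+-suc c _) (head-runEnum-delay (k (neighbour G v i)) G (suc c) first)
head-runEnum-delay (out t e) G c refl = +-identityʳ c

enumerator : ∀ {n} → Pre n → Graph n → Enum n
enumerator p G = proj₂ (runPre p G)

timedOutputs : ∀ {n} → Pre n → Graph n → List (ℕ × Triple n)
timedOutputs p G = proj₁ (runEnum (enumerator p G) G 0)

allQueriesUntilFirstOutput : ∀ {n} → Pre n → Graph n → List (Fin n)
allQueriesUntilFirstOutput p G = preQueries p G ++ queriesUntilFirstOutput (enumerator p G) G

head-timedOutputs-local : ∀ {n} (p : Pre n) (G H : Graph n) →
  AgreeOn G H (allQueriesUntilFirstOutput p G) → head (timedOutputs p G) ≡ head (timedOutputs p H)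
head-timedOutputs-local p G H agree = begin
  head (proj₁ (runEnum (enumerator p G) G 0))
    ≡⟨ head-runEnum-local (enumerator p G) G H 0 (++⁻ʳ (preQueries p G) agree) ⟩
  head (proj₁ (runEnum (enumerator p G) H 0))
    ≡⟨ cong (λ r → head (proj₁ (runEnum (proj₂ r) H 0)))
            (runPre-local p G H (++⁻ˡ (preQueries p G) agree)) ⟩
  head (proj₁ (runEnum (enumerator p H) H 0)) ∎
  where open ≡-Reasoning

emptyGraph : ∀ {n} → Graph n
emptyGraph = record { adj = λ _ → [] ; symm = λ _ _ () ; noLoop = λ _ () ; simple = λ _ → [] }

emptyGraph-IsDist : ∀ {n} {u v : Fin n} {d} → u ≢ v → IsDist emptyGraph u v d → d ≡ ∞
emptyGraph-IsDist u≢v (isFin here _)       = contradiction refl u≢v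
emptyGraph-IsDist u≢v (isFin (step () _) _)
emptyGraph-IsDist u≢v (isInf _)            = refl

module SingleEdge {n} (a b : Fin n) (a≢b : a ≢ b) where

  edgeAdj : Fin n → List (Fin n)
  edgeAdj v with v ≟ a | v ≟ b
  ... | yes _ | _     = b ∷ []
  ... | no _  | yes _ = a ∷ []
  ... | no _  | no _  = []

  b∈edgeAdj-a : b ∈ edgeAdj a
  b∈edgeAdj-a with a ≟ a | a ≟ b
  ... | yes _   | _ = here refl
  ... | no a≢a  | _ = contradiction refl a≢a

  a∈edgeAdj-b : a ∈ edgeAdj b
  a∈edgeAdj-b with b ≟ a | b ≟ b
  ... | yes b≡a | _       = contradiction (sym b≡a) a≢b
  ... | no _    | yes _   = here refl
  ... | no _    | no b≢b  = contradiction refl b≢b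

  edgeAdj-other : ∀ v → v ≢ a → v ≢ b → edgeAdj v ≡ []
  edgeAdj-other v v≢a v≢b with v ≟ a | v ≟ b
  ... | yes v≡a | _       = contradiction v≡a v≢a
  ... | no _    | yes v≡b = contradiction v≡b v≢b
  ... | no _    | no _    = refl

  ∈-edgeAdj : ∀ {v w} → w ∈ edgeAdj v → (v ≡ a × w ≡ b) ⊎ (v ≡ b × w ≡ a)
  ∈-edgeAdj {v} w∈ with v ≟ a | v ≟ b
  ∈-edgeAdj (here refl) | yes v≡a | _       = inj₁ (v≡a , refl)
  ∈-edgeAdj (here refl) | no _    | yes v≡b = inj₂ (v≡b , refl)

  edgeGraph : Graph n
  edgeGraph = record
    { adj = edgeAdj ; symm = edgeAdj-symm ; noLoop = edgeAdj-noLoop ; simple = edgeAdj-simple }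
    where
    edgeAdj-symm : ∀ u v → v ∈ edgeAdj u → u ∈ edgeAdj v
    edgeAdj-symm u v v∈ with ∈-edgeAdj v∈
    ... | inj₁ (refl , refl) = a∈edgeAdj-b
    ... | inj₂ (refl , refl) = b∈edgeAdj-a

    edgeAdj-noLoop : ∀ u → u ∉ edgeAdj u
    edgeAdj-noLoop u u∈ with ∈-edgeAdj u∈
    ... | inj₁ (refl , refl) = a≢b refl
    ... | inj₂ (refl , refl) = a≢b refl

    edgeAdj-simple : ∀ u → Unique (edgeAdj u)
    edgeAdj-simple u with u ≟ a | u ≟ b
    ... | yes _ | _     = [] ∷ []
    ... | no _  | yes _ = [] ∷ []
    ... | no _  | no _  = []

  edgeGraph-connected : ¬ IsDist edgeGraph a b ∞
  edgeGraph-connected (isInf noWalk) = noWalk 1 (step b∈edgeAdj-a here)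

  emptyGraph-AgreeOn-edgeGraph : ∀ {L} → a ∉ L → b ∉ L → AgreeOn emptyGraph edgeGraph L
  emptyGraph-AgreeOn-edgeGraph a∉L b∉L = All.tabulate λ {v} v∈L →
    sym (edgeAdj-other v (λ { refl → a∉L v∈L }) (λ { refl → b∉L v∈L }))

open SingleEdge using (edgeGraph; edgeGraph-connected; emptyGraph-AgreeOn-edgeGraph)

CorrectOutput-nonempty : ∀ {n} {G : Graph n} {u v : Fin n} → u ≢ v → ¬ CorrectOutput G []
CorrectOutput-nonempty u≢v (_ , _ , covers , _) with covers _ _ u≢v
... | ()

∞≤D⇒≡∞ : ∀ {d} → ∞ ≤D d → d ≡ ∞
∞≤D⇒≡∞ (_ ≤∞) = refl

∞-first⇒∞ : ∀ {n} {t s : Triple n} {ts} → distOf t ≡ ∞ →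
            All (λ s → distOf t ≤D distOf s) ts → s ∈ t ∷ ts → distOf s ≡ ∞
∞-first⇒∞ t∞ _   (here refl) = t∞
∞-first⇒∞ t∞ t≤ (there s∈)  = ∞≤D⇒≡∞ (subst (_≤D _) t∞ (All.lookup t≤ s∈))

head-∞⇒IsDist-∞ : ∀ {n} {G : Graph n} (xs : List (ℕ × Triple n)) {m t} →
  CorrectOutput G (map proj₂ xs) → head xs ≡ just (m , t) → distOf t ≡ ∞ →
  ∀ {u v} → u ≢ v → IsDist G u v ∞
head-∞⇒IsDist-∞ {G = G} ((m , t) ∷ xs) (valid , _ , covers , t≤ ∷ _) refl t∞ u≢v
  with ∈-map⁻ pairOf (covers _ _ u≢v)
... | (u , v , d) , s∈ , refl =
  subst (IsDist G u v) (∞-first⇒∞ t∞ t≤ s∈) (proj₂ (All.lookup valid s∈))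

emptyGraph-firstOutput : ∀ {n D} (xs : List (ℕ × Triple (2 + n))) →
  All (λ x → proj₁ x ≤ D) xs → CorrectOutput emptyGraph (map proj₂ xs) →
  ∃₂ λ m t → head xs ≡ just (m , t) × m ≤ D × distOf t ≡ ∞
emptyGraph-firstOutput [] _ correct =
  contradiction correct (CorrectOutput-nonempty {u = Fin.zero} {v = Fin.suc Fin.zero} λ ())
emptyGraph-firstOutput ((m , t) ∷ xs) (m≤D ∷ _) ((u≢v , isDist) ∷ _ , _) =
  m , t , refl , m≤D , emptyGraph-IsDist u≢v isDist

SolvesWith⇒n<P+D : ∀ A P D → SolvesWith A P D → ∀ n → n < P (2 + n) + D (2 + n)
SolvesWith⇒n<P+D A P D solves n = ≰⇒> λ budget →
  let (m , t , first₀ , m≤D , t∞) =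
        emptyGraph-firstOutput (timedOutputs p emptyGraph) (delays emptyGraph) (correct emptyGraph)
      (a , b , a≢b , a∉L , b∉L) =
        ∉-pair-exists (allQueriesUntilFirstOutput p emptyGraph) (≤-trans (queryCount m≤D first₀) budget)
      G = edgeGraph a b a≢b
      first = trans (sym (head-timedOutputs-local p emptyGraph G
                            (emptyGraph-AgreeOn-edgeGraph a b a≢b a∉L b∉L)))
                    first₀
  in edgeGraph-connected a b a≢b (head-∞⇒IsDist-∞ (timedOutputs p G) (correct G) first t∞ a≢b)
  where
  p = A (2 + n)
  delays : ∀ G → All (λ x → proj₁ x ≤ D (2 + n)) (timedOutputs p G)
  delays G = proj₁ (proj₂ (solves (2 + n) G))
  correct : ∀ G → CorrectOutput G (map proj₂ (timedOutputs p G))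
  correct G = proj₂ (proj₂ (proj₂ (solves (2 + n) G)))
  queryCount : ∀ {m t} → m ≤ D (2 + n) → head (timedOutputs p emptyGraph) ≡ just (m , t) →
               length (allQueriesUntilFirstOutput p emptyGraph) ≤ P (2 + n) + D (2 + n)
  queryCount m≤D first = begin
    length (allQueriesUntilFirstOutput p emptyGraph)
      ≡⟨ length-++ (preQueries p emptyGraph) ⟩
    length (preQueries p emptyGraph)
      + length (queriesUntilFirstOutput (enumerator p emptyGraph) emptyGraph)
      ≤⟨ +-mono-≤ (≤-trans (≤-reflexive (length-preQueries p emptyGraph))
                           (proj₁ (solves (2 + n) emptyGraph)))
                  (≤-trans (≤-reflexive (head-runEnum-delay (enumerator p emptyGraph) emptyGraph 0 first))
                           m≤D) ⟩
    P (2 + n) + D (2 + n) ∎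
    where open ≤-Reasoning

quarters⇒sum≤half+2 : ∀ p d k → 4 * p ≤ 4 + k → 4 * d ≤ 4 + k → p + d ≤ 2 + k
quarters⇒sum≤half+2 p d k 4p≤ 4d≤ = *-cancelˡ-≤ 4 (begin
  4 * (p + d)                 ≡⟨ *-distribˡ-+ 4 p d ⟩
  4 * p + 4 * d               ≤⟨ +-mono-≤ 4p≤ 4d≤ ⟩
  (4 + k) + (4 + k)           ≤⟨ m≤m+n _ (k + k) ⟩
  (4 + k) + (4 + k) + (k + k) ≡⟨ regroup k ⟩
  4 * (2 + k)                 ∎)
  where
  open ≤-Reasoning
  regroup : ∀ k → (4 + k) + (4 + k) + (k + k) ≡ 4 * (2 + k)
  regroup = solve-∀

theorem17 : ∀ (A : Algorithm) (P D : ℕ → ℕ) → SolvesWith A P D → LittleO P → LittleO D → ⊥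
theorem17 A P D solves oP oD with oP 4 | oD 4
... | N₁ , quarterP | N₂ , quarterD =
  <⇒≱ (SolvesWith⇒n<P+D A P D solves (2 + k))
      (quarters⇒sum≤half+2 (P (4 + k)) (D (4 + k)) k
        (quarterP (4 + k) (≤-trans (m≤m+n N₁ N₂) (m≤n+m k 4)))
        (quarterD (4 + k) (≤-trans (m≤n+m N₂ N₁) (m≤n+m k 4))))
  where
  k = N₁ + N₂
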